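{- Let $n\geq 2$ and let $L_n$ be the closed ladder. Then $\chi_g(L_n)=4$ if $n=2$, and $\chi_g(L_n)=5$ if $n\geq 3$.
   Context: All graphs are finite, simple and connected. A graceful $k$-coloring of a non-empty graph $G$ ($k\geq 2$) is a proper vertex coloring $f:V(G)\to\{1,2,\dots,k\}$ such that the induced edge coloring $f^*:E(G)\to\{1,\dots,k-1\}$, $f^*(uv)=|f(u)-f(v)|$, is a proper edge coloring (adjacent edges receive distinct colors). The graceful chromatic number $\chi_g(G)$ is the minimum $k$ for which $G$ has a graceful $k$-coloring. The closed ladder $L_n$ ($n\geq 2$) has vertex set $\{x_i,y_i:1\leq i\leq n\}$ and edge set $\{x_ix_{i+1},y_iy_{i+1}:1\leq i\leq n-1\}\cup\{x_iy_i:1\leq i\leq n\}$ (i.e. $L_n=P_n\Box P_2$). -}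

module Defs where

open import Data.Nat using (ℕ; zero; suc; _≤_; _<_; ∣_-_∣)
open import Data.Fin using (Fin; toℕ)
open import Data.Product using (_×_; ∃; _,_)
open import Data.Sum using (_⊎_)
open import Relation.Binary.PropositionalEquality using (_≡_; _≢_)
open import Relation.Nullary using (¬_)

record Graph : Set₁ where
  field
    V   : Set
    Adj : V → V → Set
open Graph public

-- f : V → ℕ is a graceful k-coloring: colors in {1..k}, proper vertex coloring,
-- and the induced edge coloring |f u - f v| is proper (edges sharing an endpoint
-- get distinct colors).  (Values of |f u - f v| lie in {1..k-1} automatically.)
GracefulColoring : (G : Graph) → ℕ → (V G → ℕ) → Set
GracefulColoring G k f =
  (∀ v → 1 ≤ f v × f v ≤ k)
  × (∀ u v → Adj G u v → f u ≢ f v)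
  × (∀ u v w → Adj G u v → Adj G u w → v ≢ w → ∣ f u - f v ∣ ≢ ∣ f u - f w ∣)

HasGracefulColoring : Graph → ℕ → Set
HasGracefulColoring G k = ∃ λ (f : V G → ℕ) → GracefulColoring G k f

IsGracefulChromaticNumber : Graph → ℕ → Set
IsGracefulChromaticNumber G k =
  HasGracefulColoring G k × (∀ j → j < k → ¬ HasGracefulColoring G j)

-- Closed ladder L_n = P_n □ P_2, vertices (i , 0) = x_{i+1}, (i , 1) = y_{i+1}.
LadderAdj : (n : ℕ) → Fin n × Fin 2 → Fin n × Fin 2 → Set
LadderAdj n (i , a) (j , b) =
  (a ≡ b × (toℕ j ≡ suc (toℕ i) ⊎ toℕ i ≡ suc (toℕ j)))
  ⊎ (i ≡ j × a ≢ b)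

Ladder : ℕ → Graph
Ladder n = record { V = Fin n × Fin 2 ; Adj = LadderAdj n }

-- A graceful coloring is exactly a coloring in which every vertex u has a
-- proper "star": its neighbors avoid the color of u and lie at pairwise
-- distinct distances from it.  Upper bounds are checked star by star: the
-- rows (1,2), (4,5), (2,1), (5,4) repeated with period 4 give a graceful
-- 5-coloring of the infinite ladder, hence of every L_n, and the rows (1,3),
-- (2,4) color L_2 with 4 colors.  Lower bounds use that graceful colorings
-- restrict along graph embeddings: every L_n with n ≥ 3 contains L_3, and a
-- finite search over the stars of L_3 (resp. L_2) rules out 4 (resp. 3) colors.
module Submission where

open import Defs
open import Data.Nat using (ℕ; zero; suc; _≤_; z≤n; s≤s; ∣_-_∣; _≤?_; _≟_)
open import Data.Nat.Properties using (≤-trans; ≤-pred; 1+n≢n; allUpTo?)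
open import Data.Fin using (Fin; zero; suc; toℕ; opposite; inject≤; #_) renaming (_≟_ to _≟ᶠ_)
open import Data.Fin.Properties using (toℕ-injective; toℕ-inject≤; inject≤-injective; all?)
open import Data.Product using (_×_; _,_; proj₁; proj₂; map₂)
open import Data.Product.Properties using (≡-dec)
open import Data.Sum using (_⊎_; inj₁; inj₂; [_,_]′)
open import Data.List using (List; []; _∷_; map)
open import Data.List.Membership.Propositional using (_∈_)
open import Data.List.Relation.Unary.Any using (here; there)
open import Data.List.Relation.Unary.All using (All; []; _∷_) renaming (all? to all?ᴸ)
import Data.List.Relation.Unary.All as All
import Data.List.Relation.Unary.All.Properties as All
open import Data.List.Relation.Unary.AllPairs using (AllPairs; []; _∷_; allPairs?)
import Data.List.Relation.Unary.AllPairs.Properties as AllPairs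
open import Data.Empty using (⊥-elim)
open import Function using (_∘_; id)
open import Function.Definitions using (Injective)
open import Relation.Nullary using (Dec; ¬_; ¬?; _×-dec_; _⊎-dec_)
open import Relation.Nullary.Decidable using (map′; True; toWitness; from-yes)
open import Relation.Unary using (Decidable)
open import Relation.Binary.PropositionalEquality using (_≡_; _≢_; refl; sym; cong; cong₂)

Star : ℕ → List ℕ → Set
Star c ns = All (c ≢_) ns × AllPairs (λ a b → ∣ c - a ∣ ≢ ∣ c - b ∣) ns

star? : ∀ c ns → Dec (Star c ns)
star? c ns = all?ᴸ (λ a → ¬? (c ≟ a)) ns ×-dec allPairs? (λ a b → ¬? (∣ c - a ∣ ≟ ∣ c - b ∣)) ns

LocallyGraceful : {A : Set} → (A → List A) → ℕ → (A → ℕ) → A → Set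
LocallyGraceful nbrs k f u = (1 ≤ f u × f u ≤ k) × Star (f u) (map f (nbrs u))

locallyGraceful? : ∀ {A : Set} (nbrs : A → List A) k f u → Dec (LocallyGraceful nbrs k f u)
locallyGraceful? nbrs k f u = ((1 ≤? f u) ×-dec (f u ≤? k)) ×-dec star? (f u) (map f (nbrs u))

allPairs-∈ : ∀ {A : Set} {R : A → A → Set} {xs x y} →
  AllPairs R xs → x ∈ xs → y ∈ xs → x ≢ y → R x y ⊎ R y x
allPairs-∈ _          (here refl) (here refl) x≢y = ⊥-elim (x≢y refl)
allPairs-∈ (Rx ∷ _)   (here refl) (there y∈)  _   = inj₁ (All.lookup Rx y∈)
allPairs-∈ (Ry ∷ _)   (there x∈)  (here refl) _   = inj₂ (All.lookup Ry x∈)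
allPairs-∈ (_ ∷ Rxs)  (there x∈)  (there y∈)  x≢y = allPairs-∈ Rxs x∈ y∈ x≢y

graceful⇒star : ∀ {G k f u vs} → GracefulColoring G k f →
  All (Adj G u) vs → AllPairs _≢_ vs → Star (f u) (map f vs)
graceful⇒star {G} {f = f} {u} (_ , proper , edgeProper) adjacent distinct =
  All.map⁺ (All.map (proper u _) adjacent) , AllPairs.map⁺ (distances adjacent distinct)
  where
  distances : ∀ {vs} → All (Adj G u) vs → AllPairs _≢_ vs →
    AllPairs (λ v w → ∣ f u - f v ∣ ≢ ∣ f u - f w ∣) vs
  distances [] [] = []
  distances (uv ∷ adjacent) (v≢ ∷ distinct) =
    All.zipWith (λ (uw , v≢w) → edgeProper u _ _ uv uw v≢w) (adjacent , v≢)
    ∷ distances adjacent distinct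

locallyGraceful⇒graceful : ∀ {G k f} (nbrs : V G → List (V G)) →
  (∀ {u v} → Adj G u v → v ∈ nbrs u) →
  (∀ u → LocallyGraceful nbrs k f u) → GracefulColoring G k f
locallyGraceful⇒graceful {G} {f = f} nbrs complete local =
  proj₁ ∘ local , proper , edgeProper
  where
  proper : ∀ u v → Adj G u v → f u ≢ f v
  proper u v uv = All.lookup (All.map⁻ (proj₁ (proj₂ (local u)))) (complete uv)
  edgeProper : ∀ u v w → Adj G u v → Adj G u w → v ≢ w → ∣ f u - f v ∣ ≢ ∣ f u - f w ∣
  edgeProper u v w uv uw v≢w =
    [ id , _∘ sym ]′
      (allPairs-∈ (AllPairs.map⁻ (proj₂ (proj₂ (local u)))) (complete uv) (complete uw) v≢w)

hasGraceful-mono : ∀ {G j k} → j ≤ k → HasGracefulColoring G j → HasGracefulColoring G k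
hasGraceful-mono j≤k (f , inRange , rest) =
  f , (λ v → map₂ (λ fv≤j → ≤-trans fv≤j j≤k) (inRange v)) , rest

isGracefulChromaticNumber : ∀ {G k} → HasGracefulColoring G (suc k) →
  ¬ HasGracefulColoring G k → IsGracefulChromaticNumber G (suc k)
isGracefulChromaticNumber has none =
  has , λ j j<1+k → none ∘ hasGraceful-mono (≤-pred j<1+k)

record Embedding (G H : Graph) : Set where
  field
    embed     : V G → V H
    injective : Injective _≡_ _≡_ embed
    adjacent  : ∀ {u v} → Adj G u v → Adj H (embed u) (embed v)
open Embedding

hasGraceful-restrict : ∀ {G H k} → Embedding G H →
  HasGracefulColoring H k → HasGracefulColoring G k
hasGraceful-restrict e (f , inRange , proper , edgeProper) =
  f ∘ embed e ,
  inRange ∘ embed e ,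
  (λ u v uv → proper _ _ (adjacent e uv)) ,
  λ u v w uv uw v≢w → edgeProper _ _ _ (adjacent e uv) (adjacent e uw) (v≢w ∘ injective e)

≢⇒≡opposite : ∀ {a b : Fin 2} → a ≢ b → b ≡ opposite a
≢⇒≡opposite {zero}     {zero}     a≢b = ⊥-elim (a≢b refl)
≢⇒≡opposite {zero}     {suc zero} _   = refl
≢⇒≡opposite {suc zero} {zero}     _   = refl
≢⇒≡opposite {suc zero} {suc zero} a≢b = ⊥-elim (a≢b refl)

ladderAdj? : ∀ n u v → Dec (LadderAdj n u v)
ladderAdj? n (i , a) (j , b) =
  ((a ≟ᶠ b) ×-dec ((toℕ j ≟ suc (toℕ i)) ⊎-dec (toℕ i ≟ suc (toℕ j))))
  ⊎-dec ((i ≟ᶠ j) ×-dec ¬? (a ≟ᶠ b))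

ladder-star : ∀ {n k f} → GracefulColoring (Ladder n) k f →
  (u : Fin n × Fin 2) (vs : List (Fin n × Fin 2)) →
  {True (all?ᴸ (ladderAdj? n u) vs)} →
  {True (allPairs? (λ v w → ¬? (≡-dec _≟ᶠ_ _≟ᶠ_ v w)) vs)} →
  Star (f u) (map f vs)
ladder-star graceful u vs {adjacent} {distinct} =
  graceful⇒star graceful (toWitness adjacent) (toWitness distinct)

ladder-embedding : ∀ {m n} → m ≤ n → Embedding (Ladder m) (Ladder n)
ladder-embedding {m} {n} m≤n = record
  { embed     = inject
  ; injective = λ {(i , _)} {(j , _)} e →
      cong₂ _,_ (inject≤-injective m≤n m≤n i j (cong proj₁ e)) (cong proj₂ e)
  ; adjacent  = inject-adjacent
  }
  where
  inject : Fin m × Fin 2 → Fin n × Fin 2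
  inject (i , a) = inject≤ i m≤n , a
  inject-adjacent : ∀ {u v} → LadderAdj m u v → LadderAdj n (inject u) (inject v)
  inject-adjacent {i , _} {j , _} (inj₁ (refl , rail))
    rewrite toℕ-inject≤ i m≤n | toℕ-inject≤ j m≤n = inj₁ (refl , rail)
  inject-adjacent (inj₂ (refl , a≢b)) = inj₂ (refl , a≢b)

Ladder∞Adj : ℕ × Fin 2 → ℕ × Fin 2 → Set
Ladder∞Adj (i , a) (j , b) = (a ≡ b × (j ≡ suc i ⊎ i ≡ suc j)) ⊎ (i ≡ j × a ≢ b)

Ladder∞ : Graph
Ladder∞ = record { V = ℕ × Fin 2 ; Adj = Ladder∞Adj }

ladder∞-neighbors : ℕ × Fin 2 → List (ℕ × Fin 2)
ladder∞-neighbors (zero  , a) = (1 , a) ∷ (0 , opposite a) ∷ []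
ladder∞-neighbors (suc m , a) = (suc (suc m) , a) ∷ (suc m , opposite a) ∷ (m , a) ∷ []

ladder∞-neighbors-complete : ∀ {u v} → Ladder∞Adj u v → v ∈ ladder∞-neighbors u
ladder∞-neighbors-complete {zero  , _} (inj₁ (refl , inj₁ refl)) = here refl
ladder∞-neighbors-complete {suc _ , _} (inj₁ (refl , inj₁ refl)) = here refl
ladder∞-neighbors-complete             (inj₁ (refl , inj₂ refl)) = there (there (here refl))
ladder∞-neighbors-complete {zero  , _} (inj₂ (refl , a≢b)) = there (here (cong (0 ,_) (≢⇒≡opposite a≢b)))
ladder∞-neighbors-complete {suc m , _} (inj₂ (refl , a≢b)) = there (here (cong (suc m ,_) (≢⇒≡opposite a≢b)))

ladder∞-embedding : ∀ n → Embedding (Ladder n) Ladder∞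
ladder∞-embedding n = record
  { embed     = λ (i , a) → toℕ i , a
  ; injective = λ e → cong₂ _,_ (toℕ-injective (cong proj₁ e)) (cong proj₂ e)
  ; adjacent  = λ { (inj₁ rail) → inj₁ rail ; (inj₂ (refl , a≢b)) → inj₂ (refl , a≢b) }
  }

stripes : ℕ × Fin 2 → ℕ
stripes (0 , zero)     = 1
stripes (0 , suc zero) = 2
stripes (1 , zero)     = 4
stripes (1 , suc zero) = 5
stripes (2 , zero)     = 2
stripes (2 , suc zero) = 1
stripes (3 , zero)     = 5
stripes (3 , suc zero) = 4
stripes (suc (suc (suc (suc m))) , a) = stripes (m , a)

stripes-firstRows : ∀ (r : Fin 5) a → LocallyGraceful ladder∞-neighbors 5 stripes (toℕ r , a)
stripes-firstRows =
  from-yes (all? {5} λ r → all? {2} λ a → locallyGraceful? ladder∞-neighbors 5 stripes (toℕ r , a))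

-- Row m + 5 has the colors of row m + 1 and so do its neighbors, so rows 0–4 suffice.
stripes-locallyGraceful : ∀ u → LocallyGraceful ladder∞-neighbors 5 stripes u
stripes-locallyGraceful (0 , a) = stripes-firstRows (# 0) a
stripes-locallyGraceful (1 , a) = stripes-firstRows (# 1) a
stripes-locallyGraceful (2 , a) = stripes-firstRows (# 2) a
stripes-locallyGraceful (3 , a) = stripes-firstRows (# 3) a
stripes-locallyGraceful (4 , a) = stripes-firstRows (# 4) a
stripes-locallyGraceful (suc (suc (suc (suc (suc m)))) , a) = stripes-locallyGraceful (suc m , a)

ladder-graceful-5 : ∀ n → HasGracefulColoring (Ladder n) 5
ladder-graceful-5 n =
  hasGraceful-restrict (ladder∞-embedding n)
    (stripes , locallyGraceful⇒graceful ladder∞-neighbors ladder∞-neighbors-complete stripes-locallyGraceful)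

rail⇒≢ : ∀ {n} {i j : Fin n} → toℕ j ≡ suc (toℕ i) ⊎ toℕ i ≡ suc (toℕ j) → i ≢ j
rail⇒≢ (inj₁ e) refl = 1+n≢n (sym e)
rail⇒≢ (inj₂ e) refl = 1+n≢n (sym e)

ladder₂-neighbors : Fin 2 × Fin 2 → List (Fin 2 × Fin 2)
ladder₂-neighbors (i , a) = (opposite i , a) ∷ (i , opposite a) ∷ []

ladder₂-neighbors-complete : ∀ {u v} → LadderAdj 2 u v → v ∈ ladder₂-neighbors u
ladder₂-neighbors-complete {_ , a} (inj₁ (refl , rail)) =
  here (cong (_, a) (≢⇒≡opposite (rail⇒≢ rail)))
ladder₂-neighbors-complete {i , _} (inj₂ (refl , a≢b)) =
  there (here (cong (i ,_) (≢⇒≡opposite a≢b)))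

ladder₂-coloring : Fin 2 × Fin 2 → ℕ
ladder₂-coloring (zero     , zero)     = 1
ladder₂-coloring (zero     , suc zero) = 3
ladder₂-coloring (suc zero , zero)     = 2
ladder₂-coloring (suc zero , suc zero) = 4

ladder₂-graceful-4 : HasGracefulColoring (Ladder 2) 4
ladder₂-graceful-4 =
  ladder₂-coloring ,
  locallyGraceful⇒graceful ladder₂-neighbors ladder₂-neighbors-complete (λ (i , a) → local i a)
  where
  local : ∀ i a → LocallyGraceful ladder₂-neighbors 4 ladder₂-coloring (i , a)
  local = from-yes (all? {2} λ i → all? {2} λ a →
    locallyGraceful? ladder₂-neighbors 4 ladder₂-coloring (i , a))

Stars : List (ℕ × List ℕ) → Set
Stars = All (λ (c , ns) → Star c ns)

stars? : ∀ cs → Dec (Stars cs)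
stars? = all?ᴸ (λ (c , ns) → star? c ns)

AllColors : ℕ → (ℕ → Set) → Set
AllColors k P = ∀ x → 1 ≤ x × x ≤ k → P x

allColors? : ∀ k {P : ℕ → Set} → Decidable P → Dec (AllColors k P)
allColors? k P? =
  map′ (λ { ∀x<k (suc x) (_ , x<k) → ∀x<k x<k }) (λ ∀x {x} x<k → ∀x (suc x) (s≤s z≤n , x<k))
       (allUpTo? (P? ∘ suc) k)

ladder₂-stars : (x₀ x₁ y₀ y₁ : ℕ) → List (ℕ × List ℕ)
ladder₂-stars x₀ x₁ y₀ y₁ =
  (x₀ , x₁ ∷ y₀ ∷ []) ∷ (x₁ , x₀ ∷ y₁ ∷ []) ∷ (y₀ , y₁ ∷ x₀ ∷ []) ∷ (y₁ , y₀ ∷ x₁ ∷ []) ∷ []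

ladder₂-stars-3 : AllColors 3 λ x₀ → AllColors 3 λ x₁ → AllColors 3 λ y₀ → AllColors 3 λ y₁ →
  ¬ Stars (ladder₂-stars x₀ x₁ y₀ y₁)
ladder₂-stars-3 = from-yes
  (allColors? 3 λ x₀ → allColors? 3 λ x₁ → allColors? 3 λ y₀ → allColors? 3 λ y₁ →
    ¬? (stars? (ladder₂-stars x₀ x₁ y₀ y₁)))

ladder₂-no-graceful-3 : ¬ HasGracefulColoring (Ladder 2) 3
ladder₂-no-graceful-3 (f , graceful@(inRange , _)) =
  ladder₂-stars-3 (f x₀) (inRange x₀) (f x₁) (inRange x₁) (f y₀) (inRange y₀) (f y₁) (inRange y₁)
    ( ladder-star graceful x₀ (x₁ ∷ y₀ ∷ []) ∷ ladder-star graceful x₁ (x₀ ∷ y₁ ∷ [])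
    ∷ ladder-star graceful y₀ (y₁ ∷ x₀ ∷ []) ∷ ladder-star graceful y₁ (y₀ ∷ x₁ ∷ []) ∷ [])
  where
  x₀ x₁ y₀ y₁ : Fin 2 × Fin 2
  x₀ = # 0 , # 0
  x₁ = # 1 , # 0
  y₀ = # 0 , # 1
  y₁ = # 1 , # 1

ladder₃-stars : (x₀ x₁ x₂ y₀ y₁ y₂ : ℕ) → List (ℕ × List ℕ)
ladder₃-stars x₀ x₁ x₂ y₀ y₁ y₂ =
  (x₀ , x₁ ∷ y₀ ∷ []) ∷ (x₁ , x₀ ∷ x₂ ∷ y₁ ∷ []) ∷ (x₂ , x₁ ∷ y₂ ∷ []) ∷
  (y₀ , y₁ ∷ x₀ ∷ []) ∷ (y₁ , y₀ ∷ y₂ ∷ x₁ ∷ []) ∷ (y₂ , y₁ ∷ x₂ ∷ []) ∷ []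

ladder₃-stars-4 : AllColors 4 λ x₀ → AllColors 4 λ x₁ → AllColors 4 λ x₂ →
  AllColors 4 λ y₀ → AllColors 4 λ y₁ → AllColors 4 λ y₂ →
  ¬ Stars (ladder₃-stars x₀ x₁ x₂ y₀ y₁ y₂)
ladder₃-stars-4 = from-yes
  (allColors? 4 λ x₀ → allColors? 4 λ x₁ → allColors? 4 λ x₂ →
   allColors? 4 λ y₀ → allColors? 4 λ y₁ → allColors? 4 λ y₂ →
    ¬? (stars? (ladder₃-stars x₀ x₁ x₂ y₀ y₁ y₂)))

ladder₃-no-graceful-4 : ¬ HasGracefulColoring (Ladder 3) 4
ladder₃-no-graceful-4 (f , graceful@(inRange , _)) =
  ladder₃-stars-4 (f x₀) (inRange x₀) (f x₁) (inRange x₁) (f x₂) (inRange x₂)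
                  (f y₀) (inRange y₀) (f y₁) (inRange y₁) (f y₂) (inRange y₂)
    ( ladder-star graceful x₀ (x₁ ∷ y₀ ∷ []) ∷ ladder-star graceful x₁ (x₀ ∷ x₂ ∷ y₁ ∷ [])
    ∷ ladder-star graceful x₂ (x₁ ∷ y₂ ∷ []) ∷ ladder-star graceful y₀ (y₁ ∷ x₀ ∷ [])
    ∷ ladder-star graceful y₁ (y₀ ∷ y₂ ∷ x₁ ∷ []) ∷ ladder-star graceful y₂ (y₁ ∷ x₂ ∷ []) ∷ [])
  where
  x₀ x₁ x₂ y₀ y₁ y₂ : Fin 3 × Fin 2
  x₀ = # 0 , # 0
  x₁ = # 1 , # 0
  x₂ = # 2 , # 0
  y₀ = # 0 , # 1
  y₁ = # 1 , # 1
  y₂ = # 2 , # 1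

theorem3p2 : (n : ℕ) → 2 ≤ n →
    (n ≡ 2 → IsGracefulChromaticNumber (Ladder n) 4)
    × (3 ≤ n → IsGracefulChromaticNumber (Ladder n) 5)
theorem3p2 n _ = ladder₂ , longLadder
  where
  ladder₂ : n ≡ 2 → IsGracefulChromaticNumber (Ladder n) 4
  ladder₂ refl = isGracefulChromaticNumber ladder₂-graceful-4 ladder₂-no-graceful-3
  longLadder : 3 ≤ n → IsGracefulChromaticNumber (Ladder n) 5
  longLadder 3≤n =
    isGracefulChromaticNumber (ladder-graceful-5 n)
      (ladder₃-no-graceful-4 ∘ hasGraceful-restrict (ladder-embedding 3≤n))
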